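{- Let $\Gamma$ and $\Delta$ be multisets of $\mathcal{L}_u$-formulas with $\Delta$ containing at most one formula. For every tree-like $G$-proof $\pi$ of $\Gamma\Rightarrow\Delta$ there exist a multiset $\Sigma_\pi$ of single-variable $\mathcal{L}_u$-formulas and an $\mathbf{FL_e}$-proof $\sigma_\pi$ of $\Sigma_\pi,\Gamma\Rightarrow\Delta$ such that $|\Sigma_\pi|\le O(|\pi|)$, $|\sigma_\pi|\le O(|\pi|^3)$, and $\mathbf{LK}\vdash\ \Rightarrow\bigwedge\Sigma_\pi^f$.
   Context: $\mathcal{L}_u$-formulas are built from atoms and constants $0,1$ by $\wedge,\vee,*,\to$; $\neg A:=A\to0$. A formula is single-variable if it contains at most one atom. $|\Sigma|$ denotes the total number of symbols in a multiset; sizes of proofs are numbers of symbols. $\mathbf{FL_e}$ is the single-conclusion sequent calculus (sequents $\Gamma\Rightarrow\Delta$, finite multisets, $|\Delta|\le1$) with axioms $A\Rightarrow A$, $\Rightarrow1$, $0\Rightarrow$ and rules: from $\Gamma\Rightarrow\Delta$ infer $\Gamma,1\Rightarrow\Delta$; from $\Gamma\Rightarrow$ infer $\Gamma\Rightarrow0$; from $\Gamma,A_i\Rightarrow\Delta$ infer $\Gamma,A_0\wedge A_1\Rightarrow\Delta$; from $\Gamma\Rightarrow A$ and $\Gamma\Rightarrow B$ infer $\Gamma\Rightarrow A\wedge B$; from $\Gamma,A\Rightarrow\Delta$ and $\Gamma,B\Rightarrow\Delta$ infer $\Gamma,A\vee B\Rightarrow\Delta$; from $\Gamma\Rightarrow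 A_i$ infer $\Gamma\Rightarrow A_0\vee A_1$; from $\Gamma,A,B\Rightarrow\Delta$ infer $\Gamma,A*B\Rightarrow\Delta$; from $\Gamma\Rightarrow A$ and $\Sigma\Rightarrow B$ infer $\Gamma,\Sigma\Rightarrow A*B$; from $\Gamma\Rightarrow A$ and $\Sigma,B\Rightarrow\Lambda$ infer $\Gamma,\Sigma,A\to B\Rightarrow\Lambda$; from $\Gamma,A\Rightarrow B$ infer $\Gamma\Rightarrow A\to B$; cut: from $\Gamma\Rightarrow A$ and $\Sigma,A\Rightarrow\Lambda$ infer $\Gamma,\Sigma\Rightarrow\Lambda$. $G$ is $\mathbf{FL_e}$ plus the additional initial sequents, for every atom $p$: $\Rightarrow p\vee\neg p$, $p\Rightarrow1$, $\neg p\Rightarrow1$, $0\Rightarrow p$, $0\Rightarrow\neg p$, and $0\Rightarrow0*0$ (only for atoms; no substitution instances). A proof is tree-like if every sequent occurrence is used at most once as a premise. $\mathbf{LK}$ is the classical sequent calculus over $\mathcal{L}_p$ (atoms, $\top,\bot,\wedge,\vee,\to$) with weakening, contraction and cut. The forgetful translation $(\cdot)^f$: $p^f=p$, $0^f=\bot$, $1^f=\top$, $(A*B)^f=A^f\wedge B^f$, $(A\circ B)^f=A^f\circ B^f$ for $\circ\in\{\wedge,\vee,\to\}$; applied elementwise to multisets. -}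

module Defs where

open import Data.Nat using (ℕ; zero; suc; _+_; _*_; _≤_; _^_)
open import Data.List using (List; []; _∷_; _++_; [_]; map; concatMap)
open import Data.List.Relation.Unary.All using (All)
open import Data.List.Relation.Unary.Unique.Propositional using (Unique)
open import Data.List.Relation.Binary.Pointwise using (Pointwise)
open import Data.List.Relation.Binary.Permutation.Propositional using (_↭_)
open import Data.Maybe using (Maybe; just; nothing)
open import Data.Product using (Σ; _×_; ∃; ∃-syntax)
open import Data.Unit using (⊤)
open import Data.Empty using (⊥)
open import Relation.Binary.PropositionalEquality using (_≡_)

infixr 6 _∧_
infixr 5 _∨_
infixr 7 _⊛_
infixr 4 _⟶_

data Fm : Set where
  var  : ℕ → Fm
  𝟎 𝟏  : Fm
  _∧_ _∨_ _⊛_ _⟶_ : Fm → Fm → Fm      -- ⊛ is the multiplicative conjunction *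

¬ᵤ_ : Fm → Fm
¬ᵤ A = A ⟶ 𝟎

fsize : Fm → ℕ
fsize (var _) = 1
fsize 𝟎 = 1
fsize 𝟏 = 1
fsize (A ∧ B) = suc (fsize A + fsize B)
fsize (A ∨ B) = suc (fsize A + fsize B)
fsize (A ⊛ B) = suc (fsize A + fsize B)
fsize (A ⟶ B) = suc (fsize A + fsize B)

msize : List Fm → ℕ
msize [] = 0
msize (A ∷ As) = fsize A + msize As

vars : Fm → List ℕ
vars (var p) = [ p ]
vars 𝟎 = []
vars 𝟏 = []
vars (A ∧ B) = vars A ++ vars B
vars (A ∨ B) = vars A ++ vars B
vars (A ⊛ B) = vars A ++ vars B
vars (A ⟶ B) = vars A ++ vars B

SingleVar : Fm → Set
SingleVar A = ∃[ p ] All (_≡ p) (vars A)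

-- Single-conclusion sequents Γ ⇒ Δ, |Δ| ≤ 1 (Δ : Maybe Fm)

infix 3 _⇒_
record Sequent : Set where
  constructor _⇒_
  field
    ant : List Fm
    succ : Maybe Fm
open Sequent public

-- equality of sequents as pairs of multisets
infix 3 _≈ₛ_
_≈ₛ_ : Sequent → Sequent → Set
(Γ ⇒ Δ) ≈ₛ (Γ' ⇒ Δ') = (Γ ↭ Γ') × (Δ ≡ Δ')

msize? : Maybe Fm → ℕ
msize? nothing = 0
msize? (just A) = fsize A

-- number of symbols of a sequent (formulas plus the symbol ⇒)
ssize : Sequent → ℕ
ssize (Γ ⇒ Δ) = suc (msize Γ + msize? Δ)

-- Rule instances of FL_e, extended by a set Ax of extra initial sequents.
-- Inf Ax ps c : c follows from the premises ps (in this order) by one rule.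

data Inf (Ax : Sequent → Set) : List Sequent → Sequent → Set where
  init  : ∀ {s} → Ax s → Inf Ax [] s
  id    : ∀ A → Inf Ax [] ([ A ] ⇒ just A)
  one-R : Inf Ax [] ([] ⇒ just 𝟏)
  zero-L : Inf Ax [] ([ 𝟎 ] ⇒ nothing)
  one-L : ∀ Γ Δ → Inf Ax [ Γ ⇒ Δ ] (𝟏 ∷ Γ ⇒ Δ)
  zero-R : ∀ Γ → Inf Ax [ Γ ⇒ nothing ] (Γ ⇒ just 𝟎)
  ∧L₀   : ∀ Γ A B Δ → Inf Ax [ A ∷ Γ ⇒ Δ ] ((A ∧ B) ∷ Γ ⇒ Δ)
  ∧L₁   : ∀ Γ A B Δ → Inf Ax [ B ∷ Γ ⇒ Δ ] ((A ∧ B) ∷ Γ ⇒ Δ)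
  ∧R    : ∀ Γ A B → Inf Ax ((Γ ⇒ just A) ∷ [ Γ ⇒ just B ]) (Γ ⇒ just (A ∧ B))
  ∨L    : ∀ Γ A B Δ → Inf Ax ((A ∷ Γ ⇒ Δ) ∷ [ B ∷ Γ ⇒ Δ ]) ((A ∨ B) ∷ Γ ⇒ Δ)
  ∨R₀   : ∀ Γ A B → Inf Ax [ Γ ⇒ just A ] (Γ ⇒ just (A ∨ B))
  ∨R₁   : ∀ Γ A B → Inf Ax [ Γ ⇒ just B ] (Γ ⇒ just (A ∨ B))
  ⊛L    : ∀ Γ A B Δ → Inf Ax [ A ∷ B ∷ Γ ⇒ Δ ] ((A ⊛ B) ∷ Γ ⇒ Δ)
  ⊛R    : ∀ Γ Σ' A B → Inf Ax ((Γ ⇒ just A) ∷ [ Σ' ⇒ just B ]) (Γ ++ Σ' ⇒ just (A ⊛ B))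
  ⟶L    : ∀ Γ Σ' A B Λ → Inf Ax ((Γ ⇒ just A) ∷ [ B ∷ Σ' ⇒ Λ ]) ((A ⟶ B) ∷ Γ ++ Σ' ⇒ Λ)
  ⟶R    : ∀ Γ A B → Inf Ax [ A ∷ Γ ⇒ just B ] (Γ ⇒ just (A ⟶ B))
  cut   : ∀ Γ Σ' A Λ → Inf Ax ((Γ ⇒ just A) ∷ [ A ∷ Σ' ⇒ Λ ]) (Γ ++ Σ' ⇒ Λ)

-- a rule instance, with sequents read as multisets
Step : (Sequent → Set) → List Sequent → Sequent → Set
Step Ax ps c = ∃[ ps' ] ∃[ c' ] (Inf Ax ps' c' × Pointwise _≈ₛ_ ps ps' × (c ≈ₛ c'))

NoAx : Sequent → Set
NoAx _ = ⊥

data GAx : Sequent → Set where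
  em    : ∀ p → GAx ([] ⇒ just (var p ∨ ¬ᵤ var p))
  p-1   : ∀ p → GAx ([ var p ] ⇒ just 𝟏)
  np-1  : ∀ p → GAx ([ ¬ᵤ var p ] ⇒ just 𝟏)
  zero-p : ∀ p → GAx ([ 𝟎 ] ⇒ just (var p))
  zero-np : ∀ p → GAx ([ 𝟎 ] ⇒ just (¬ᵤ var p))
  zero-00 : GAx ([ 𝟎 ] ⇒ just (𝟎 ⊛ 𝟎))

-- Proofs (in general DAG-like) as sequences of lines; each line carries a
-- sequent and the indices (0-based positions) of earlier lines used as premises.

record Line : Set where
  constructor line
  field
    sequent : Sequent
    prems   : List ℕ
open Line public

nth : {A : Set} → List A → ℕ → Maybe A
nth [] _ = nothing
nth (x ∷ xs) zero = just x
nth (x ∷ xs) (suc n) = nth xs n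

ValidFrom : (Sequent → Set) → List Sequent → List Line → Set
ValidFrom Ax prev [] = ⊤
ValidFrom Ax prev (l ∷ ls) =
  (∃[ ps ] (Pointwise (λ i s → nth prev i ≡ just s) (prems l) ps × Step Ax ps (sequent l)))
  × ValidFrom Ax (prev ++ [ sequent l ]) ls

lastSeq : List Line → Maybe Sequent
lastSeq [] = nothing
lastSeq (l ∷ []) = just (sequent l)
lastSeq (l ∷ l' ∷ ls) = lastSeq (l' ∷ ls)

IsProof : (Sequent → Set) → List Line → Sequent → Set
IsProof Ax π s = ValidFrom Ax [] π × ∃[ t ] (lastSeq π ≡ just t × (t ≈ₛ s))

TreeLike : List Line → Set
TreeLike π = Unique (concatMap prems π)

psize : List Line → ℕ
psize [] = 0
psize (l ∷ ls) = ssize (sequent l) + psize ls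

infixr 6 _∧ₚ_
infixr 5 _∨ₚ_
infixr 4 _→ₚ_

data PFm : Set where
  pvar : ℕ → PFm
  ⊤ₚ ⊥ₚ : PFm
  _∧ₚ_ _∨ₚ_ _→ₚ_ : PFm → PFm → PFm

infix 2 _⊢LK_
data _⊢LK_ : List PFm → List PFm → Set where
  ax    : ∀ A → [ A ] ⊢LK [ A ]
  ⊥L    : [ ⊥ₚ ] ⊢LK []
  ⊤R    : [] ⊢LK [ ⊤ₚ ]
  exL   : ∀ {Γ Γ' Δ} → Γ ↭ Γ' → Γ ⊢LK Δ → Γ' ⊢LK Δ
  exR   : ∀ {Γ Δ Δ'} → Δ ↭ Δ' → Γ ⊢LK Δ → Γ ⊢LK Δ'
  wL    : ∀ {Γ Δ} A → Γ ⊢LK Δ → A ∷ Γ ⊢LK Δ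
  wR    : ∀ {Γ Δ} A → Γ ⊢LK Δ → Γ ⊢LK A ∷ Δ
  cL    : ∀ {Γ Δ A} → A ∷ A ∷ Γ ⊢LK Δ → A ∷ Γ ⊢LK Δ
  cR    : ∀ {Γ Δ A} → Γ ⊢LK A ∷ A ∷ Δ → Γ ⊢LK A ∷ Δ
  ∧L₁   : ∀ {Γ Δ A} B → A ∷ Γ ⊢LK Δ → (A ∧ₚ B) ∷ Γ ⊢LK Δ
  ∧L₂   : ∀ {Γ Δ B} A → B ∷ Γ ⊢LK Δ → (A ∧ₚ B) ∷ Γ ⊢LK Δ
  ∧R    : ∀ {Γ Δ A B} → Γ ⊢LK A ∷ Δ → Γ ⊢LK B ∷ Δ → Γ ⊢LK (A ∧ₚ B) ∷ Δ
  ∨L    : ∀ {Γ Δ A B} → A ∷ Γ ⊢LK Δ → B ∷ Γ ⊢LK Δ → (A ∨ₚ B) ∷ Γ ⊢LK Δ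
  ∨R₁   : ∀ {Γ Δ A} B → Γ ⊢LK A ∷ Δ → Γ ⊢LK (A ∨ₚ B) ∷ Δ
  ∨R₂   : ∀ {Γ Δ B} A → Γ ⊢LK B ∷ Δ → Γ ⊢LK (A ∨ₚ B) ∷ Δ
  →L    : ∀ {Γ Δ Σ' Λ A B} → Γ ⊢LK A ∷ Δ → B ∷ Σ' ⊢LK Λ → (A →ₚ B) ∷ Γ ++ Σ' ⊢LK Δ ++ Λ
  →R    : ∀ {Γ Δ A B} → A ∷ Γ ⊢LK B ∷ Δ → Γ ⊢LK (A →ₚ B) ∷ Δ
  cut   : ∀ {Γ Δ Σ' Λ A} → Γ ⊢LK A ∷ Δ → A ∷ Σ' ⊢LK Λ → Γ ++ Σ' ⊢LK Δ ++ Λ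

forget : Fm → PFm
forget (var p) = pvar p
forget 𝟎 = ⊥ₚ
forget 𝟏 = ⊤ₚ
forget (A ∧ B) = forget A ∧ₚ forget B
forget (A ∨ B) = forget A ∨ₚ forget B
forget (A ⊛ B) = forget A ∧ₚ forget B
forget (A ⟶ B) = forget A →ₚ forget B

⋀ : List PFm → PFm
⋀ [] = ⊤ₚ
⋀ (A ∷ []) = A
⋀ (A ∷ B ∷ As) = A ∧ₚ ⋀ (B ∷ As)

-- Each initial sequent of G follows in FL_e from a single hypothesis X ∧ 𝟏 in which X is a
-- single-variable classical tautology: p ∨ ¬p for excluded middle and A ⟶ B for the initial
-- sequents A ⇒ B. A tree-like proof unfolds into a derivation tree of the same size. Adding the
-- hypotheses of all its leaves to the antecedents turns the tree into an FL_e derivation: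
-- context-splitting rules (⊛R, ⟶L, cut) distribute the hypotheses among their premises, and for
-- the context-sharing rules (∧R, ∨L) each premise is weakened by the hypotheses of the other one,
-- which FL_e allows for formulas X ∧ 𝟏 (by 𝟏L and ∧L). The hypotheses have at most 7|π| symbols, so
-- every sequent has O(|π|) symbols, and each of the O(|π|) nodes adds O(|π|) weakening steps.

module Submission where

open import Defs
open import Data.Nat using (ℕ; suc; _+_; _*_; _≤_; _^_; _≤ᵇ_; z≤n; s≤s; >-nonZero)
open import Data.Nat.Properties
open import Algebra.Properties.CommutativeSemigroup +-commutativeSemigroup using (x∙yz≈y∙xz)
open import Data.Nat.ListAction using (sum)
open import Data.Nat.ListAction.Properties using (sum-++; sum-↭)
open import Data.Nat.Tactic.RingSolver using (solve-∀)
open import Data.Bool using (T)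
open import Data.List using (List; []; _∷_; _++_; [_]; map; length; concatMap)
open import Data.List.Properties using (++-assoc; ++-identityʳ; map-++)
open import Data.List.Relation.Unary.All as All using (All; []; _∷_)
open import Data.List.Relation.Unary.All.Properties using (++⁺; ∷ʳ⁺; map⁺)
open import Data.List.Relation.Unary.AllPairs using (_∷_)
open import Data.List.Relation.Unary.Unique.Propositional using (Unique)
open import Data.List.Relation.Binary.Pointwise using (Pointwise; []; _∷_)
import Data.List.Relation.Binary.Pointwise as Pointwise
open import Data.List.Relation.Binary.Permutation.Propositional
  using (_↭_; ↭-refl; ↭-sym; ↭-trans; ↭-reflexive; prep; swap)
import Data.List.Relation.Binary.Permutation.Propositional.Properties as ↭
open import Data.Maybe using (Maybe; just; nothing; maybe; Is-just; to-witness)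
open import Data.Maybe.Relation.Unary.Any using (just)
open import Data.Product using (_×_; _,_; proj₁; proj₂; ∃; ∃-syntax)
open import Data.Sum using (_⊎_; inj₁; inj₂)
open import Data.Unit using (tt)
open import Data.Empty using (⊥; ⊥-elim)
open import Function using (_∘_)
open import Relation.Binary.PropositionalEquality
  using (_≡_; _≢_; refl; sym; trans; cong; cong₂; subst; module ≡-Reasoning)

-- Sequents and their sizes

≈ₛ-refl : ∀ {s} → s ≈ₛ s
≈ₛ-refl = ↭-refl , refl

≈ₛ-sym : ∀ {s t} → s ≈ₛ t → t ≈ₛ s
≈ₛ-sym (p , e) = ↭-sym p , sym e

≈ₛ-trans : ∀ {s t u} → s ≈ₛ t → t ≈ₛ u → s ≈ₛ u
≈ₛ-trans (p , e) (q , f) = ↭-trans p q , trans e f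

infixr 4 _,,_

_,,_ : List Fm → Sequent → Sequent
Σ ,, s = Σ ++ ant s ⇒ succ s

,,-cong : ∀ Σ {s t} → s ≈ₛ t → Σ ,, s ≈ₛ Σ ,, t
,,-cong Σ (p , e) = ↭.++⁺ˡ Σ p , e

,,-++ : ∀ Σ Θ {s} → Σ ,, Θ ,, s ≈ₛ (Σ ++ Θ) ,, s
,,-++ Σ Θ {s} = ↭-reflexive (sym (++-assoc Σ Θ (ant s))) , refl

,,-swap : ∀ Σ Θ {s} → Θ ,, Σ ,, s ≈ₛ (Σ ++ Θ) ,, s
,,-swap Σ Θ {s} = ≈ₛ-trans (↭.shifts Θ Σ , refl) (,,-++ Σ Θ)

,,-front : ∀ Θ Σ {Γ Δ} → Σ ,, (Θ ++ Γ ⇒ Δ) ≈ₛ (Θ ++ Σ ++ Γ ⇒ Δ)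
,,-front Θ Σ = ↭.shifts Σ Θ , refl

↭-interchange : ∀ (Σ Θ Γ Λ : List Fm) → (Σ ++ Θ) ++ Γ ++ Λ ↭ (Σ ++ Γ) ++ Θ ++ Λ
↭-interchange Σ Θ Γ Λ = ↭-trans (↭-reflexive (++-assoc Σ Θ (Γ ++ Λ)))
  (↭-trans (↭.++⁺ˡ Σ (↭.shifts Θ Γ)) (↭-reflexive (sym (++-assoc Σ Γ (Θ ++ Λ)))))

msize≡sum : ∀ Γ → msize Γ ≡ sum (map fsize Γ)
msize≡sum [] = refl
msize≡sum (A ∷ Γ) = cong (fsize A +_) (msize≡sum Γ)

msize-++ : ∀ Γ Λ → msize (Γ ++ Λ) ≡ msize Γ + msize Λ
msize-++ Γ Λ = begin
  msize (Γ ++ Λ)                        ≡⟨ msize≡sum (Γ ++ Λ) ⟩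
  sum (map fsize (Γ ++ Λ))              ≡⟨ cong sum (map-++ fsize Γ Λ) ⟩
  sum (map fsize Γ ++ map fsize Λ)      ≡⟨ sum-++ (map fsize Γ) (map fsize Λ) ⟩
  sum (map fsize Γ) + sum (map fsize Λ) ≡⟨ sym (cong₂ _+_ (msize≡sum Γ) (msize≡sum Λ)) ⟩
  msize Γ + msize Λ                     ∎
  where open ≡-Reasoning

msize-↭ : ∀ {Γ Λ} → Γ ↭ Λ → msize Γ ≡ msize Λ
msize-↭ {Γ} {Λ} p = begin
  msize Γ             ≡⟨ msize≡sum Γ ⟩
  sum (map fsize Γ)   ≡⟨ sum-↭ (↭.map⁺ fsize p) ⟩
  sum (map fsize Λ)   ≡⟨ sym (msize≡sum Λ) ⟩
  msize Λ             ∎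
  where open ≡-Reasoning

length≤msize : ∀ Γ → length Γ ≤ msize Γ
length≤msize [] = z≤n
length≤msize (A ∷ Γ) = +-mono-≤ (fsize≥1 A) (length≤msize Γ)
  where
  fsize≥1 : ∀ A → 1 ≤ fsize A
  fsize≥1 (var _) = s≤s z≤n
  fsize≥1 𝟎 = s≤s z≤n
  fsize≥1 𝟏 = s≤s z≤n
  fsize≥1 (_ ∧ _) = s≤s z≤n
  fsize≥1 (_ ∨ _) = s≤s z≤n
  fsize≥1 (_ ⊛ _) = s≤s z≤n
  fsize≥1 (_ ⟶ _) = s≤s z≤n

ssize-∷ : ∀ A Γ Δ → ssize (A ∷ Γ ⇒ Δ) ≡ fsize A + ssize (Γ ⇒ Δ)
ssize-∷ A Γ Δ = trans (cong suc (+-assoc (fsize A) (msize Γ) (msize? Δ))) (sym (+-suc (fsize A) _))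

ssize-∷-mono : ∀ {A B Γ Δ} → fsize A ≤ fsize B → ssize (A ∷ Γ ⇒ Δ) ≤ ssize (B ∷ Γ ⇒ Δ)
ssize-∷-mono A≤B = s≤s (+-monoˡ-≤ _ (+-monoˡ-≤ _ A≤B))

ssize-,, : ∀ Σ s → ssize (Σ ,, s) ≡ msize Σ + ssize s
ssize-,, [] s = refl
ssize-,, (A ∷ Σ) s = begin
  ssize (A ∷ Σ ,, s)             ≡⟨ ssize-∷ A (Σ ++ ant s) (succ s) ⟩
  fsize A + ssize (Σ ,, s)       ≡⟨ cong (fsize A +_) (ssize-,, Σ s) ⟩
  fsize A + (msize Σ + ssize s)  ≡⟨ sym (+-assoc (fsize A) (msize Σ) (ssize s)) ⟩
  msize (A ∷ Σ) + ssize s        ∎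
  where open ≡-Reasoning

ssize-resp : ∀ {s t} → s ≈ₛ t → ssize s ≡ ssize t
ssize-resp {Γ ⇒ Δ} (p , refl) = cong (λ n → suc (n + msize? Δ)) (msize-↭ p)

-- Derivation trees

Inf⇒Step : ∀ {Ax ps c} → Inf Ax ps c → Step Ax ps c
Inf⇒Step inf = _ , _ , inf , Pointwise.refl ≈ₛ-refl , ≈ₛ-refl

Step-resp : ∀ {Ax ps qs c d} → Pointwise _≈ₛ_ ps qs → c ≈ₛ d → Step Ax qs d → Step Ax ps c
Step-resp ps≈qs c≈d (rs , e , inf , qs≈rs , d≈e) =
  rs , e , inf , Pointwise.transitive ≈ₛ-trans ps≈qs qs≈rs , ≈ₛ-trans c≈d d≈e

no-ternary-rule : ∀ {Ax p q r ps c} → Step Ax (p ∷ q ∷ r ∷ ps) c → ⊥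
no-ternary-rule (_ , _ , () , _ ∷ _ ∷ _ ∷ _ , _)

data Tree (Ax : Sequent → Set) : Sequent → Set where
  node : ∀ {ps c} → Step Ax ps c → All (Tree Ax) ps → Tree Ax c

tsize : ∀ {Ax c} → Tree Ax c → ℕ
tsizes : ∀ {Ax ps} → All (Tree Ax) ps → ℕ

tsize {c = c} (node _ ts) = tsizes ts + ssize c
tsizes [] = 0
tsizes (t ∷ ts) = tsize t + tsizes ts

childrenSize : ∀ {Ax c} → Tree Ax c → ℕ
childrenSize (node _ ts) = tsizes ts

Tree-resp : ∀ {Ax c d} → c ≈ₛ d → Tree Ax d → Tree Ax c
Tree-resp c≈d (node st ts) = node (Step-resp (Pointwise.refl ≈ₛ-refl) c≈d st) ts

tsize-resp : ∀ {Ax c d} (c≈d : c ≈ₛ d) (t : Tree Ax d) → tsize (Tree-resp c≈d t) ≡ tsize t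
tsize-resp c≈d (node _ ts) = cong (tsizes ts +_) (ssize-resp c≈d)

ssize≤tsize : ∀ {Ax c} (t : Tree Ax c) → ssize c ≤ tsize t
ssize≤tsize (node _ ts) = m≤n+m _ (tsizes ts)

child₁≤tsize : ∀ {Ax p ps c} (st : Step Ax (p ∷ ps) c) t ts → tsize t ≤ tsize (node st (t ∷ ts))
child₁≤tsize _ t ts = ≤-trans (m≤m+n (tsize t) (tsizes ts)) (m≤m+n _ _)

child₂≤tsize : ∀ {Ax p q ps c} (st : Step Ax (p ∷ q ∷ ps) c) t₁ t₂ ts →
  tsize t₂ ≤ tsize (node st (t₁ ∷ t₂ ∷ ts))
child₂≤tsize _ t₁ t₂ ts = ≤-trans (m≤m+n (tsize t₂) (tsizes ts)) (≤-trans (m≤n+m _ (tsize t₁)) (m≤m+n _ _))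

1≤tsize : ∀ {Ax c} (t : Tree Ax c) → 1 ≤ tsize t
1≤tsize t = ≤-trans (s≤s z≤n) (ssize≤tsize t)

-- Serialising trees into line proofs

infixl 5 _⊕_

_⊕_ : List Sequent → List Line → List Sequent
prev ⊕ ls = prev ++ map sequent ls

⊕-++ : ∀ prev ls ms → prev ⊕ (ls ++ ms) ≡ prev ⊕ ls ⊕ ms
⊕-++ prev ls ms = trans (cong (prev ++_) (map-++ sequent ls ms)) (sym (++-assoc prev _ _))

At : List Sequent → List ℕ → List Sequent → Set
At prev = Pointwise (λ i s → nth prev i ≡ just s)

nth-++ : ∀ {A : Set} (xs ys : List A) {i a} → nth xs i ≡ just a → nth (xs ++ ys) i ≡ just a
nth-++ (x ∷ xs) ys {0} e = e
nth-++ (x ∷ xs) ys {suc i} e = nth-++ xs ys e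

nth-∷ʳ : ∀ {A : Set} (xs : List A) a → nth (xs ++ [ a ]) (length xs) ≡ just a
nth-∷ʳ [] a = refl
nth-∷ʳ (x ∷ xs) a = nth-∷ʳ xs a

lastSeq-∷ʳ : ∀ ls l → lastSeq (ls ++ [ l ]) ≡ just (sequent l)
lastSeq-∷ʳ [] l = refl
lastSeq-∷ʳ (_ ∷ []) l = refl
lastSeq-∷ʳ (_ ∷ l′ ∷ ls) l = lastSeq-∷ʳ (l′ ∷ ls) l

psize-++ : ∀ ls ms → psize (ls ++ ms) ≡ psize ls + psize ms
psize-++ [] ms = refl
psize-++ (l ∷ ls) ms =
  trans (cong (ssize (sequent l) +_) (psize-++ ls ms)) (sym (+-assoc (ssize (sequent l)) (psize ls) (psize ms)))

ValidFrom-++ : ∀ {Ax} prev ls ms → ValidFrom Ax prev ls → ValidFrom Ax (prev ⊕ ls) ms → ValidFrom Ax prev (ls ++ ms)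
ValidFrom-++ prev [] ms _ v = subst (λ xs → ValidFrom _ xs ms) (++-identityʳ prev) v
ValidFrom-++ prev (l ∷ ls) ms (vl , vls) v =
  vl , ValidFrom-++ (prev ++ [ sequent l ]) ls ms vls (subst (λ xs → ValidFrom _ xs ms) (sym (++-assoc prev _ _)) v)

treeLines : ∀ {Ax c} prev (t : Tree Ax c) →
  ∃[ ls ] (ValidFrom Ax prev ls × lastSeq ls ≡ just c × (∃[ r ] nth (prev ⊕ ls) r ≡ just c) × psize ls ≡ tsize t)
forestLines : ∀ {Ax ps} prev (ts : All (Tree Ax) ps) →
  ∃[ ls ] ∃[ rs ] (ValidFrom Ax prev ls × At (prev ⊕ ls) rs ps × psize ls ≡ tsizes ts)

treeLines {c = c} prev (node st ts) with ls , rs , valid , at , size ← forestLines prev ts =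
  ls ++ [ line c rs ] ,
  ValidFrom-++ prev ls _ valid ((_ , at , st) , tt) ,
  lastSeq-∷ʳ ls _ ,
  (length (prev ⊕ ls) ,
    subst (λ xs → nth xs (length (prev ⊕ ls)) ≡ just c) (sym (⊕-++ prev ls _)) (nth-∷ʳ (prev ⊕ ls) c)) ,
  trans (psize-++ ls _) (cong₂ _+_ size (+-identityʳ (ssize c)))

forestLines prev [] = [] , [] , tt , [] , refl
forestLines prev (t ∷ ts)
  with ls , valid , _ , (r , root) , size ← treeLines prev t
  with ms , rs , valid′ , at , size′ ← forestLines (prev ⊕ ls) ts =
  ls ++ ms , r ∷ rs ,
  ValidFrom-++ prev ls ms valid valid′ ,
  subst (λ xs → At xs (r ∷ rs) _) (sym (⊕-++ prev ls ms)) (nth-++ (prev ⊕ ls) _ root ∷ at) ,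
  trans (psize-++ ls ms) (cong₂ _+_ size size′)

Tree⇒IsProof : ∀ {Ax c} (t : Tree Ax c) → ∃[ ls ] (IsProof Ax ls c × psize ls ≡ tsize t)
Tree⇒IsProof {c = c} t with ls , valid , last , _ , size ← treeLines [] t = ls , (valid , c , last , ≈ₛ-refl) , size

-- Unfolding tree-like line proofs

-- Reading the lines in order, the pool holds the trees of those lines read so far that are not yet
-- used as premises. Tree-likeness lets each tree be taken at most once, so the pool never outgrows
-- the lines read.
Pool : (Sequent → Set) → List Sequent → Set
Pool Ax = All (λ s → Maybe (Tree Ax s))

poolSize : ∀ {Ax prev} → Pool Ax prev → ℕ
poolSize [] = 0
poolSize (m ∷ ms) = maybe tsize 0 m + poolSize ms

lookup : ∀ {Ax prev i s} → Pool Ax prev → nth prev i ≡ just s → Maybe (Tree Ax s)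
lookup {i = 0} (m ∷ _) refl = m
lookup {i = suc i} (_ ∷ ms) e = lookup ms e

remove : ∀ {Ax prev} → ℕ → Pool Ax prev → Pool Ax prev
remove _ [] = []
remove 0 (_ ∷ ms) = nothing ∷ ms
remove (suc i) (m ∷ ms) = m ∷ remove i ms

Available : ∀ {Ax prev} → Pool Ax prev → ℕ → Set
Available {prev = prev} pool i = ∀ s (e : nth prev i ≡ just s) → Is-just (lookup pool e)

lookup-remove : ∀ {Ax prev i j s} (pool : Pool Ax prev) (e : nth prev j ≡ just s) →
  i ≢ j → lookup (remove i pool) e ≡ lookup pool e
lookup-remove {i = 0} {0} (_ ∷ _) refl i≢j = ⊥-elim (i≢j refl)
lookup-remove {i = 0} {suc j} (_ ∷ _) e _ = refl
lookup-remove {i = suc i} {0} (_ ∷ _) refl _ = refl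
lookup-remove {i = suc i} {suc j} (_ ∷ ms) e i≢j = lookup-remove ms e (i≢j ∘ cong suc)

poolSize-remove : ∀ {Ax prev i s} (pool : Pool Ax prev) (e : nth prev i ≡ just s) (a : Is-just (lookup pool e)) →
  poolSize pool ≡ tsize (to-witness a) + poolSize (remove i pool)
poolSize-remove {i = 0} (just _ ∷ _) refl (just _) = refl
poolSize-remove {i = suc i} (m ∷ ms) e a = begin
  maybe tsize 0 m + poolSize ms
    ≡⟨ cong (maybe tsize 0 m +_) (poolSize-remove ms e a) ⟩
  maybe tsize 0 m + (tsize (to-witness a) + poolSize (remove i ms))
    ≡⟨ x∙yz≈y∙xz (maybe tsize 0 m) (tsize (to-witness a)) (poolSize (remove i ms)) ⟩
  tsize (to-witness a) + (maybe tsize 0 m + poolSize (remove i ms)) ∎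
  where open ≡-Reasoning

available-remove : ∀ {Ax prev i j} (pool : Pool Ax prev) → i ≢ j × Available pool j → Available (remove i pool) j
available-remove pool (i≢j , a) s e = subst Is-just (sym (lookup-remove pool e i≢j)) (a s e)

available-∷ʳ : ∀ {Ax prev s j} (pool : Pool Ax prev) (t : Tree Ax s) →
  Available pool j → Available (∷ʳ⁺ pool (just t)) j
available-∷ʳ {j = 0} [] t _ _ refl = just tt
available-∷ʳ {j = 0} (_ ∷ _) t a _ refl = a _ refl
available-∷ʳ {j = suc j} (_ ∷ ms) t a = available-∷ʳ ms t a

poolSize-∷ʳ : ∀ {Ax prev s} (pool : Pool Ax prev) (t : Tree Ax s) →
  poolSize (∷ʳ⁺ pool (just t)) ≡ poolSize pool + tsize t
poolSize-∷ʳ [] t = +-identityʳ (tsize t)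
poolSize-∷ʳ (m ∷ ms) t = trans (cong (maybe tsize 0 m +_) (poolSize-∷ʳ ms t)) (sym (+-assoc (maybe tsize 0 m) _ _))

takeAll : ∀ {Ax prev ps} (pool : Pool Ax prev) is {rest} → Unique (is ++ rest) → All (Available pool) (is ++ rest) →
  At prev is ps →
  ∃ λ (ts : All (Tree Ax) ps) → ∃ λ (pool′ : Pool Ax prev) →
    Unique rest × All (Available pool′) rest × poolSize pool ≡ tsizes ts + poolSize pool′
takeAll pool [] u as [] = [] , pool , u , as , refl
takeAll pool (i ∷ is) (i∉ ∷ u) (a ∷ as) (e ∷ es)
  with ts , pool′ , u′ , as′ , size ← takeAll (remove i pool) is u (All.zipWith (available-remove pool) (i∉ , as)) es =
  to-witness (a _ e) ∷ ts , pool′ , u′ , as′ ,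
  trans (poolSize-remove pool e (a _ e))
    (trans (cong (tsize (to-witness (a _ e)) +_) size) (sym (+-assoc (tsize (to-witness (a _ e))) (tsizes ts) (poolSize pool′))))

unfoldLine : ∀ {Ax prev rest} (pool : Pool Ax prev) l →
  Unique (prems l ++ rest) → All (Available pool) (prems l ++ rest) →
  ∃[ ps ] (At prev (prems l) ps × Step Ax ps (sequent l)) →
  ∃ λ (t : Tree Ax (sequent l)) → ∃ λ (pool′ : Pool Ax prev) →
    Unique rest × All (Available pool′) rest × poolSize pool′ + tsize t ≡ poolSize pool + ssize (sequent l)
unfoldLine pool l u as (_ , es , st) with ts , pool′ , u′ , as′ , size ← takeAll pool (prems l) u as es =
  node st ts , pool′ , u′ , as′ , (begin
    poolSize pool′ + (tsizes ts + ssize (sequent l))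
      ≡⟨ sym (+-assoc (poolSize pool′) _ _) ⟩
    poolSize pool′ + tsizes ts + ssize (sequent l)
      ≡⟨ cong (_+ ssize (sequent l)) (trans (+-comm (poolSize pool′) _) (sym size)) ⟩
    poolSize pool + ssize (sequent l) ∎)
  where open ≡-Reasoning

unfold : ∀ {Ax prev s} (pool : Pool Ax prev) ls →
  Unique (concatMap prems ls) → All (Available pool) (concatMap prems ls) →
  ValidFrom Ax prev ls → lastSeq ls ≡ just s → ∃[ t ] tsize {Ax} {s} t ≤ poolSize pool + psize ls
unfold pool (l ∷ []) u as (vl , _) refl with t , pool′ , _ , _ , size ← unfoldLine pool l u as vl = t , (begin
  tsize t                             ≤⟨ m≤n+m (tsize t) (poolSize pool′) ⟩
  poolSize pool′ + tsize t            ≡⟨ size ⟩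
  poolSize pool + ssize (sequent l)   ≡⟨ cong (poolSize pool +_) (sym (+-identityʳ _)) ⟩
  poolSize pool + psize (l ∷ [])      ∎)
  where open ≤-Reasoning
unfold {Ax} pool (l ∷ l′ ∷ ls) u as (vl , valid) last =
  let t , pool′ , u′ , as′ , size = unfoldLine pool l u as vl
      t′ , size′ = unfold {Ax} (∷ʳ⁺ pool′ (just t)) (l′ ∷ ls) u′
        (All.map (available-∷ʳ pool′ t) as′) valid last
  in t′ , (begin
    tsize t′
      ≤⟨ size′ ⟩
    poolSize (∷ʳ⁺ pool′ (just t)) + psize (l′ ∷ ls)
      ≡⟨ cong (_+ psize (l′ ∷ ls)) (trans (poolSize-∷ʳ pool′ t) size) ⟩
    poolSize pool + ssize (sequent l) + psize (l′ ∷ ls)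
      ≡⟨ +-assoc (poolSize pool) _ _ ⟩
    poolSize pool + psize (l ∷ l′ ∷ ls) ∎)
  where open ≤-Reasoning

TreeLike⇒Tree : ∀ {Ax π s} → TreeLike π → IsProof Ax π s → ∃[ t ] tsize {Ax} {s} t ≤ psize π
TreeLike⇒Tree {π = π} u (valid , _ , last , t≈s) with t , size ← unfold [] π u (All.universal (λ _ _ ()) _) valid last =
  Tree-resp (≈ₛ-sym t≈s) t , ≤-trans (≤-reflexive (tsize-resp (≈ₛ-sym t≈s) t)) size

-- Adding hypotheses to the antecedents of rule instances

axiom-or-rule : ∀ {Ax c} → Inf Ax [] c → Ax c ⊎ Inf NoAx [] c
axiom-or-rule (init a) = inj₁ a
axiom-or-rule (id A) = inj₂ (id A)
axiom-or-rule one-R = inj₂ one-R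
axiom-or-rule zero-L = inj₂ zero-L

extendInf₁ : ∀ {Ax p c} → Inf Ax [ p ] c → ∀ Σ → Step NoAx [ Σ ,, p ] (Σ ,, c)
extendInf₁ (one-L Γ Δ) Σ = _ , _ , one-L (Σ ++ Γ) Δ , ≈ₛ-refl ∷ [] , ,,-front [ 𝟏 ] Σ
extendInf₁ (zero-R Γ) Σ = Inf⇒Step (zero-R (Σ ++ Γ))
extendInf₁ (∧L₀ Γ A B Δ) Σ = _ , _ , ∧L₀ (Σ ++ Γ) A B Δ , ,,-front [ A ] Σ ∷ [] , ,,-front [ A ∧ B ] Σ
extendInf₁ (∧L₁ Γ A B Δ) Σ = _ , _ , ∧L₁ (Σ ++ Γ) A B Δ , ,,-front [ B ] Σ ∷ [] , ,,-front [ A ∧ B ] Σ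
extendInf₁ (∨R₀ Γ A B) Σ = Inf⇒Step (∨R₀ (Σ ++ Γ) A B)
extendInf₁ (∨R₁ Γ A B) Σ = Inf⇒Step (∨R₁ (Σ ++ Γ) A B)
extendInf₁ (⊛L Γ A B Δ) Σ = _ , _ , ⊛L (Σ ++ Γ) A B Δ , ,,-front (A ∷ B ∷ []) Σ ∷ [] , ,,-front [ A ⊛ B ] Σ
extendInf₁ (⟶R Γ A B) Σ = _ , _ , ⟶R (Σ ++ Γ) A B , ,,-front [ A ] Σ ∷ [] , ≈ₛ-refl

extend₁ : ∀ {s c} → Step GAx [ s ] c → ∀ Σ → Step NoAx [ Σ ,, s ] (Σ ,, c)
extend₁ (_ , _ , inf , s≈p ∷ [] , c≈d) Σ = Step-resp (,,-cong Σ s≈p ∷ []) (,,-cong Σ c≈d) (extendInf₁ inf Σ)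

data Extension₂ (Σ₁ Σ₂ : List Fm) (s₁ s₂ c : Sequent) : Set where
  split : Step NoAx ((Σ₁ ,, s₁) ∷ [ Σ₂ ,, s₂ ]) ((Σ₁ ++ Σ₂) ,, c) → Extension₂ Σ₁ Σ₂ s₁ s₂ c
  share : Step NoAx ((Σ₂ ,, Σ₁ ,, s₁) ∷ [ Σ₁ ,, Σ₂ ,, s₂ ]) ((Σ₁ ++ Σ₂) ,, c) →
          Extension₂ Σ₁ Σ₂ s₁ s₂ c

extendInf₂ : ∀ {Ax p₁ p₂ c} → Inf Ax (p₁ ∷ [ p₂ ]) c → ∀ Σ₁ Σ₂ → Extension₂ Σ₁ Σ₂ p₁ p₂ c
extendInf₂ (∧R Γ A B) Σ₁ Σ₂ =
  share (_ , _ , ∧R ((Σ₁ ++ Σ₂) ++ Γ) A B , ,,-swap Σ₁ Σ₂ ∷ ,,-++ Σ₁ Σ₂ ∷ [] , ≈ₛ-refl)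
extendInf₂ (∨L Γ A B Δ) Σ₁ Σ₂ = share (_ , _ , ∨L ((Σ₁ ++ Σ₂) ++ Γ) A B Δ ,
  ≈ₛ-trans (,,-swap Σ₁ Σ₂) (,,-front [ A ] (Σ₁ ++ Σ₂)) ∷
  ≈ₛ-trans (,,-++ Σ₁ Σ₂) (,,-front [ B ] (Σ₁ ++ Σ₂)) ∷ [] ,
  ,,-front [ A ∨ B ] (Σ₁ ++ Σ₂))
extendInf₂ (⊛R Γ Λ A B) Σ₁ Σ₂ = split (_ , _ , ⊛R (Σ₁ ++ Γ) (Σ₂ ++ Λ) A B ,
  ≈ₛ-refl ∷ ≈ₛ-refl ∷ [] , (↭-interchange Σ₁ Σ₂ Γ Λ , refl))
extendInf₂ (⟶L Γ Λ A B Δ) Σ₁ Σ₂ = split (_ , _ , ⟶L (Σ₁ ++ Γ) (Σ₂ ++ Λ) A B Δ ,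
  ≈ₛ-refl ∷ ,,-front [ B ] Σ₂ ∷ [] ,
  ≈ₛ-trans (,,-front [ A ⟶ B ] (Σ₁ ++ Σ₂)) (prep (A ⟶ B) (↭-interchange Σ₁ Σ₂ Γ Λ) , refl))
extendInf₂ (cut Γ Λ A Δ) Σ₁ Σ₂ = split (_ , _ , cut (Σ₁ ++ Γ) (Σ₂ ++ Λ) A Δ ,
  ≈ₛ-refl ∷ ,,-front [ A ] Σ₂ ∷ [] , (↭-interchange Σ₁ Σ₂ Γ Λ , refl))

extend₂ : ∀ {s₁ s₂ c} → Step GAx (s₁ ∷ [ s₂ ]) c → ∀ Σ₁ Σ₂ → Extension₂ Σ₁ Σ₂ s₁ s₂ c
extend₂ (_ , _ , inf , s₁≈p₁ ∷ s₂≈p₂ ∷ [] , c≈d) Σ₁ Σ₂ with extendInf₂ inf Σ₁ Σ₂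
... | split st = split (Step-resp (,,-cong Σ₁ s₁≈p₁ ∷ ,,-cong Σ₂ s₂≈p₂ ∷ []) (,,-cong (Σ₁ ++ Σ₂) c≈d) st)
... | share st = share (Step-resp (,,-cong Σ₂ (,,-cong Σ₁ s₁≈p₁) ∷ ,,-cong Σ₁ (,,-cong Σ₂ s₂≈p₂) ∷ [])
                                  (,,-cong (Σ₁ ++ Σ₂) c≈d) st)

-- Hypotheses

Weakenable : Fm → Set
Weakenable A = ∃[ X ] A ≡ X ∧ 𝟏

weaken : ∀ {Σ s} → All Weakenable Σ → Tree NoAx s → Tree NoAx (Σ ,, s)
weaken [] d = d
weaken {_ ∷ Σ} {s} ((X , refl) ∷ ws) d =
  node (Inf⇒Step (∧L₁ (Σ ++ ant s) X 𝟏 (succ s)))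
    (node (Inf⇒Step (one-L (Σ ++ ant s) (succ s))) (weaken ws d ∷ []) ∷ [])

tsize-weaken : ∀ {Σ s M} (ws : All Weakenable Σ) (d : Tree NoAx s) → ssize (Σ ,, s) ≤ M →
  tsize (weaken ws d) ≤ tsize d + length Σ * (2 * M)
tsize-weaken [] d _ = m≤m+n (tsize d) 0
tsize-weaken {_ ∷ Σ} {s} {M} ((X , refl) ∷ ws) d ≤M = begin
  tsize (weaken ws d) + 0 + ssize (𝟏 ∷ Σ ,, s) + 0 + ssize (X ∧ 𝟏 ∷ Σ ,, s)
    ≤⟨ +-mono-≤ (+-monoˡ-≤ 0 (+-mono-≤ (+-monoˡ-≤ 0 (tsize-weaken ws d Σ≤M)) 𝟏≤M)) ≤M ⟩
  tsize d + length Σ * (2 * M) + 0 + M + 0 + M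
    ≡⟨ rearrange (tsize d) (length Σ) M ⟩
  tsize d + length (X ∧ 𝟏 ∷ Σ) * (2 * M) ∎
  where
  open ≤-Reasoning
  𝟏≤M : ssize (𝟏 ∷ Σ ,, s) ≤ M
  𝟏≤M = ≤-trans (ssize-∷-mono {𝟏} {X ∧ 𝟏} {Σ ++ ant s} {succ s} (s≤s z≤n)) ≤M
  Σ≤M : ssize (Σ ,, s) ≤ M
  Σ≤M = ≤-trans (n≤1+n _) 𝟏≤M
  rearrange : ∀ a l M → a + l * (2 * M) + 0 + M + 0 + M ≡ a + suc l * (2 * M)
  rearrange = solve-∀

⊢∧⊤ : ∀ {B} → [] ⊢LK [ B ] → [] ⊢LK [ B ∧ₚ ⊤ₚ ]
⊢∧⊤ ⊢B = ∧R ⊢B ⊤R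

⊢→⊤ : ∀ B → [] ⊢LK [ B →ₚ ⊤ₚ ]
⊢→⊤ B = →R (wL B ⊤R)

⊢⊥→ : ∀ B → [] ⊢LK [ ⊥ₚ →ₚ B ]
⊢⊥→ B = →R (wR B ⊥L)

⊢excluded-middle : ∀ B → [] ⊢LK [ B ∨ₚ (B →ₚ ⊥ₚ) ]
⊢excluded-middle B = cR (∨R₁ (B →ₚ ⊥ₚ) (exR (swap _ _ ↭-refl) (∨R₂ B (→R (wR ⊥ₚ (ax B))))))

⊢⋀ : ∀ {Bs} → All (λ B → [] ⊢LK [ B ]) Bs → [] ⊢LK [ ⋀ Bs ]
⊢⋀ [] = ⊤R
⊢⋀ (⊢B ∷ []) = ⊢B
⊢⋀ (⊢B ∷ ⊢C ∷ ⊢Bs) = ∧R ⊢B (⊢⋀ (⊢C ∷ ⊢Bs))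

Hypothesis : Fm → Set
Hypothesis A = Weakenable A × SingleVar A × ([] ⊢LK [ forget A ])

record AxiomHypothesis (a : Sequent) : Set where
  field
    hyp : Fm
    hyp-ok : Hypothesis hyp
    hyp-size : fsize hyp ≤ 7
    derivation : Tree NoAx ([ hyp ] ,, a)
    derivation-size : tsize derivation ≤ 32

mkAxiomHypothesis : ∀ {a} X → SingleVar (X ∧ 𝟏) → [] ⊢LK [ forget X ] → (d : Tree NoAx ([ X ∧ 𝟏 ] ,, a)) →
  T (fsize X ≤ᵇ 5) → T (tsize d ≤ᵇ 32) → AxiomHypothesis a
mkAxiomHypothesis X sv ⊢X d X≤5 d≤32 =
  record { hyp = X ∧ 𝟏 ; hyp-ok = (X , refl) , sv , ⊢∧⊤ ⊢X
         ; hyp-size = s≤s (+-monoˡ-≤ 1 (≤ᵇ⇒≤ _ 5 X≤5))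
         ; derivation = d ; derivation-size = ≤ᵇ⇒≤ _ 32 d≤32 }

identity : ∀ A → Tree NoAx ([ A ] ⇒ just A)
identity A = node (Inf⇒Step (id A)) []

∧𝟏-elim : ∀ X → Tree NoAx ([ X ∧ 𝟏 ] ⇒ just X)
∧𝟏-elim X = node (Inf⇒Step (∧L₀ [] X 𝟏 (just X))) (identity X ∷ [])

modusPonens : ∀ A B → Tree NoAx ((A ⟶ B) ∧ 𝟏 ∷ [ A ] ⇒ just B)
modusPonens A B = node (Inf⇒Step (∧L₀ [ A ] (A ⟶ B) 𝟏 (just B)))
  (node (Inf⇒Step (⟶L [ A ] [] A B (just B))) (identity A ∷ identity B ∷ []) ∷ [])

axiomHypothesis : ∀ {a} → GAx a → AxiomHypothesis a
axiomHypothesis (em p) =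
  mkAxiomHypothesis (var p ∨ ¬ᵤ var p) (p , refl ∷ refl ∷ []) (⊢excluded-middle (pvar p)) (∧𝟏-elim _) tt tt
axiomHypothesis (p-1 p) =
  mkAxiomHypothesis (var p ⟶ 𝟏) (p , refl ∷ []) (⊢→⊤ (pvar p)) (modusPonens _ _) tt tt
axiomHypothesis (np-1 p) =
  mkAxiomHypothesis (¬ᵤ var p ⟶ 𝟏) (p , refl ∷ []) (⊢→⊤ (pvar p →ₚ ⊥ₚ)) (modusPonens _ _) tt tt
axiomHypothesis (zero-p p) =
  mkAxiomHypothesis (𝟎 ⟶ var p) (p , refl ∷ []) (⊢⊥→ (pvar p)) (modusPonens _ _) tt tt
axiomHypothesis (zero-np p) =
  mkAxiomHypothesis (𝟎 ⟶ ¬ᵤ var p) (p , refl ∷ []) (⊢⊥→ (pvar p →ₚ ⊥ₚ)) (modusPonens _ _) tt tt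
axiomHypothesis zero-00 =
  mkAxiomHypothesis (𝟎 ⟶ 𝟎 ⊛ 𝟎) (0 , []) (⊢⊥→ (⊥ₚ ∧ₚ ⊥ₚ)) (modusPonens _ _) tt tt

-- The translation

children-cost₁ : ∀ {x a K} → x ≤ a * K → x + 0 ≤ (a + 0) * K + 0
children-cost₁ {x} {a} {K} x≤ = begin
  x + 0             ≡⟨ +-identityʳ x ⟩
  x                 ≤⟨ x≤ ⟩
  a * K             ≡⟨ rearrange a K ⟩
  (a + 0) * K + 0   ∎
  where
  open ≤-Reasoning
  rearrange : ∀ a K → a * K ≡ (a + 0) * K + 0
  rearrange = solve-∀

children-cost₂ : ∀ {x₁ x₂} a₁ a₂ l₁ l₂ K c → x₁ ≤ a₁ * K + l₂ * c → x₂ ≤ a₂ * K + l₁ * c →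
  x₁ + (x₂ + 0) ≤ (a₁ + (a₂ + 0)) * K + (l₁ + l₂) * c
children-cost₂ {x₁} {x₂} a₁ a₂ l₁ l₂ K c x₁≤ x₂≤ = begin
  x₁ + (x₂ + 0)                                ≤⟨ +-mono-≤ x₁≤ (+-monoˡ-≤ 0 x₂≤) ⟩
  a₁ * K + l₂ * c + (a₂ * K + l₁ * c + 0)      ≡⟨ rearrange a₁ a₂ l₁ l₂ K c ⟩
  (a₁ + (a₂ + 0)) * K + (l₁ + l₂) * c          ∎
  where
  open ≤-Reasoning
  rearrange : ∀ a₁ a₂ l₁ l₂ K c →
    a₁ * K + l₂ * c + (a₂ * K + l₁ * c + 0) ≡ (a₁ + (a₂ + 0)) * K + (l₁ + l₂) * c
  rearrange = solve-∀

-- N bounds the size of the whole G-derivation. Every translated sequent has at most seqBound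
-- symbols, and each symbol of the G-derivation pays for budget symbols of the FL_e derivation.
module Translate (N : ℕ) (1≤N : 1 ≤ N) where

  seqBound : ℕ
  seqBound = 8 * N

  budget : ℕ
  budget = seqBound * (15 * N)

  ,,-bounded : ∀ Σ s → msize Σ ≤ 7 * N → ssize s ≤ N → ssize (Σ ,, s) ≤ seqBound
  ,,-bounded Σ s Σ≤ s≤ = begin
    ssize (Σ ,, s)     ≡⟨ trans (ssize-,, Σ s) (+-comm (msize Σ) (ssize s)) ⟩
    ssize s + msize Σ  ≤⟨ +-mono-≤ s≤ Σ≤ ⟩
    seqBound           ∎
    where open ≤-Reasoning

  32≤budget : 32 ≤ budget
  32≤budget = ≤-trans (≤ᵇ⇒≤ 32 120 tt) (*-mono-≤ (*-monoʳ-≤ 8 1≤N) (*-monoʳ-≤ 15 1≤N))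

  budget-covers : ∀ {l r} → l ≤ 7 * N → r ≤ seqBound → r + l * (2 * seqBound) ≤ budget
  budget-covers {l} {r} l≤ r≤ = begin
    r + l * (2 * seqBound)             ≤⟨ +-mono-≤ r≤ (*-monoˡ-≤ (2 * seqBound) l≤) ⟩
    seqBound + 7 * N * (2 * seqBound)  ≡⟨ factor N ⟩
    seqBound * (1 + 14 * N)            ≤⟨ *-monoʳ-≤ seqBound (+-monoˡ-≤ (14 * N) 1≤N) ⟩
    budget                             ∎
    where
    open ≤-Reasoning
    factor : ∀ N → 8 * N + 7 * N * (2 * (8 * N)) ≡ 8 * N * (1 + 14 * N)
    factor = solve-∀

  -- l hypotheses are weakened into the children of d, at two sequents each.
  node-cost : ∀ {l c e} (d : Tree NoAx e) (g : Tree GAx c) →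
    childrenSize d ≤ childrenSize g * budget + l * (2 * seqBound) → l ≤ 7 * N → ssize e ≤ seqBound →
    tsize d ≤ tsize g * budget
  node-cost {l} {c} {e} (node _ ds) (node _ ts) ds≤ l≤ e≤ = begin
    tsizes ds + ssize e                          ≤⟨ +-monoˡ-≤ (ssize e) ds≤ ⟩
    b * budget + l * (2 * seqBound) + ssize e    ≡⟨ +-assoc (b * budget) _ (ssize e) ⟩
    b * budget + (l * (2 * seqBound) + ssize e)  ≡⟨ cong (b * budget +_) (+-comm _ (ssize e)) ⟩
    b * budget + (ssize e + l * (2 * seqBound))  ≤⟨ +-monoʳ-≤ (b * budget) (budget-covers l≤ e≤) ⟩
    b * budget + budget                          ≤⟨ +-monoʳ-≤ (b * budget) (m≤n*m budget (ssize c)) ⟩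
    b * budget + ssize c * budget                ≡⟨ sym (*-distribʳ-+ budget b (ssize c)) ⟩
    (b + ssize c) * budget                       ∎
    where
    open ≤-Reasoning
    b : ℕ
    b = tsizes ts

  record Translation {c : Sequent} (g : Tree GAx c) : Set where
    field
      hyps : List Fm
      hyps-ok : All Hypothesis hyps
      derivation : Tree NoAx (hyps ,, c)
      hyps-size : msize hyps ≤ 7 * tsize g
      derivation-size : tsize derivation ≤ tsize g * budget

  translate-leaf : ∀ {c} (st : Step GAx [] c) → Translation (node st [])
  translate-leaf {c} (_ , _ , inf , [] , c≈a) with axiom-or-rule inf
  ... | inj₂ inf′ = record
    { hyps = [] ; hyps-ok = [] ; derivation = node (_ , _ , inf′ , [] , c≈a) [] ; hyps-size = z≤n
    ; derivation-size = m≤m*n (ssize c) budget {{>-nonZero (≤-trans (s≤s z≤n) 32≤budget)}} }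
  ... | inj₁ a = record
    { hyps = [ hyp ] ; hyps-ok = hyp-ok ∷ [] ; derivation = Tree-resp (,,-cong [ hyp ] c≈a) derivation
    ; hyps-size = ≤-trans (≤-reflexive (+-identityʳ (fsize hyp))) (≤-trans hyp-size (m≤m*n 7 (ssize c)))
    ; derivation-size = begin
        tsize (Tree-resp (,,-cong [ hyp ] c≈a) derivation)  ≡⟨ tsize-resp (,,-cong [ hyp ] c≈a) derivation ⟩
        tsize derivation                                    ≤⟨ derivation-size ⟩
        32                                                  ≤⟨ 32≤budget ⟩
        budget                                              ≤⟨ m≤n*m budget (ssize c) ⟩
        ssize c * budget                                    ∎ }
    where
    open AxiomHypothesis (axiomHypothesis a)
    open ≤-Reasoning

  translate-unary : ∀ {s c} (st : Step GAx [ s ] c) {t : Tree GAx s} → Translation t →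
    tsize (node st (t ∷ [])) ≤ N → Translation (node st (t ∷ []))
  translate-unary {c = c} st {t} tr g≤N = record
    { hyps = hyps ; hyps-ok = hyps-ok
    ; derivation = d
    ; hyps-size = ≤-trans hyps-size (*-monoʳ-≤ 7 t≤g)
    ; derivation-size = node-cost d g (children-cost₁ {a = tsize t} derivation-size) z≤n
        (,,-bounded hyps c (≤-trans hyps-size (*-monoʳ-≤ 7 (≤-trans t≤g g≤N))) (≤-trans (ssize≤tsize g) g≤N)) }
    where
    open Translation tr
    g : Tree GAx c
    g = node st (t ∷ [])
    d : Tree NoAx (hyps ,, c)
    d = node (extend₁ st hyps) (derivation ∷ [])
    t≤g : tsize t ≤ tsize g
    t≤g = child₁≤tsize st t []

  hyps-++-size : ∀ {s₁ s₂ c} (st : Step GAx (s₁ ∷ [ s₂ ]) c) {t₁ : Tree GAx s₁} {t₂ : Tree GAx s₂}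
    (tr₁ : Translation t₁) (tr₂ : Translation t₂) →
    msize (Translation.hyps tr₁ ++ Translation.hyps tr₂) ≤ 7 * tsize (node st (t₁ ∷ t₂ ∷ []))
  hyps-++-size {c = c} st {t₁} {t₂} tr₁ tr₂ = begin
    msize (Σ₁ ++ Σ₂)               ≡⟨ msize-++ Σ₁ Σ₂ ⟩
    msize Σ₁ + msize Σ₂            ≤⟨ +-mono-≤ Σ₁≤ Σ₂≤ ⟩
    7 * tsize t₁ + 7 * tsize t₂    ≡⟨ sym (*-distribˡ-+ 7 (tsize t₁) (tsize t₂)) ⟩
    7 * (tsize t₁ + tsize t₂)      ≤⟨ *-monoʳ-≤ 7 (≤-trans (+-monoʳ-≤ (tsize t₁) (m≤m+n (tsize t₂) 0)) (m≤m+n _ (ssize c))) ⟩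
    7 * tsize (node st (t₁ ∷ t₂ ∷ [])) ∎
    where
    open ≤-Reasoning
    open Translation tr₁ renaming (hyps to Σ₁; hyps-size to Σ₁≤)
    open Translation tr₂ renaming (hyps to Σ₂; hyps-size to Σ₂≤)

  binary-derivation : ∀ {s₁ s₂ c} (st : Step GAx (s₁ ∷ [ s₂ ]) c) {t₁ : Tree GAx s₁} {t₂ : Tree GAx s₂}
    (tr₁ : Translation t₁) (tr₂ : Translation t₂) → tsize (node st (t₁ ∷ t₂ ∷ [])) ≤ N →
    Extension₂ (Translation.hyps tr₁) (Translation.hyps tr₂) s₁ s₂ c →
    ∃ λ (d : Tree NoAx ((Translation.hyps tr₁ ++ Translation.hyps tr₂) ,, c)) →
      tsize d ≤ tsize (node st (t₁ ∷ t₂ ∷ [])) * budget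
  binary-derivation {s₁} {s₂} {c} st {t₁} {t₂} tr₁ tr₂ g≤N = combine
    where
    open Translation tr₁ renaming (hyps to Σ₁; hyps-ok to ok₁; derivation to d₁; derivation-size to d₁≤)
    open Translation tr₂ renaming (hyps to Σ₂; hyps-ok to ok₂; derivation to d₂; derivation-size to d₂≤)
    g : Tree GAx c
    g = node st (t₁ ∷ t₂ ∷ [])
    Σ≤N : msize (Σ₁ ++ Σ₂) ≤ 7 * N
    Σ≤N = ≤-trans (hyps-++-size st tr₁ tr₂) (*-monoʳ-≤ 7 g≤N)
    fits : ∀ {s} (t : Tree GAx s) → tsize t ≤ tsize g → ssize ((Σ₁ ++ Σ₂) ,, s) ≤ seqBound
    fits {s} t t≤g = ,,-bounded (Σ₁ ++ Σ₂) s Σ≤N (≤-trans (ssize≤tsize t) (≤-trans t≤g g≤N))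
    l≤N : length Σ₁ + length Σ₂ ≤ 7 * N
    l≤N = ≤-trans (+-mono-≤ (length≤msize Σ₁) (length≤msize Σ₂))
      (≤-trans (≤-reflexive (sym (msize-++ Σ₁ Σ₂))) Σ≤N)
    ws₁ : All Weakenable Σ₁
    ws₁ = All.map proj₁ ok₁
    ws₂ : All Weakenable Σ₂
    ws₂ = All.map proj₁ ok₂
    w₁ : Tree NoAx (Σ₂ ,, Σ₁ ,, s₁)
    w₁ = weaken ws₂ d₁
    w₂ : Tree NoAx (Σ₁ ,, Σ₂ ,, s₂)
    w₂ = weaken ws₁ d₂
    w₁≤ : tsize w₁ ≤ tsize t₁ * budget + length Σ₂ * (2 * seqBound)
    w₁≤ = ≤-trans (tsize-weaken ws₂ d₁ (≤-trans (≤-reflexive (ssize-resp (,,-swap Σ₁ Σ₂ {s₁})))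
                                                (fits t₁ (child₁≤tsize st t₁ (t₂ ∷ [])))))
                  (+-monoˡ-≤ _ d₁≤)
    w₂≤ : tsize w₂ ≤ tsize t₂ * budget + length Σ₁ * (2 * seqBound)
    w₂≤ = ≤-trans (tsize-weaken ws₁ d₂ (≤-trans (≤-reflexive (ssize-resp (,,-++ Σ₁ Σ₂ {s₂})))
                                                (fits t₂ (child₂≤tsize st t₁ t₂ []))))
                  (+-monoˡ-≤ _ d₂≤)
    combine : Extension₂ Σ₁ Σ₂ s₁ s₂ c → ∃ λ (d : Tree NoAx ((Σ₁ ++ Σ₂) ,, c)) → tsize d ≤ tsize g * budget
    combine (split st′) = node st′ (d₁ ∷ d₂ ∷ []) ,
      node-cost (node st′ (d₁ ∷ d₂ ∷ [])) g
        (children-cost₂ (tsize t₁) (tsize t₂) 0 0 budget (2 * seqBound)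
          (≤-trans d₁≤ (m≤m+n _ 0)) (≤-trans d₂≤ (m≤m+n _ 0)))
        z≤n (fits g ≤-refl)
    combine (share st′) = node st′ (w₁ ∷ w₂ ∷ []) ,
      node-cost (node st′ (w₁ ∷ w₂ ∷ [])) g
        (children-cost₂ (tsize t₁) (tsize t₂) (length Σ₁) (length Σ₂) budget (2 * seqBound) w₁≤ w₂≤)
        l≤N (fits g ≤-refl)

  translate-binary : ∀ {s₁ s₂ c} (st : Step GAx (s₁ ∷ [ s₂ ]) c) {t₁ : Tree GAx s₁} {t₂ : Tree GAx s₂} →
    Translation t₁ → Translation t₂ → tsize (node st (t₁ ∷ t₂ ∷ [])) ≤ N →
    Translation (node st (t₁ ∷ t₂ ∷ []))
  translate-binary st tr₁ tr₂ g≤N = record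
    { hyps = hyps₁ ++ hyps₂
    ; hyps-ok = ++⁺ ok₁ ok₂
    ; derivation = proj₁ (binary-derivation st tr₁ tr₂ g≤N (extend₂ st hyps₁ hyps₂))
    ; hyps-size = hyps-++-size st tr₁ tr₂
    ; derivation-size = proj₂ (binary-derivation st tr₁ tr₂ g≤N (extend₂ st hyps₁ hyps₂)) }
    where
    open Translation tr₁ renaming (hyps to hyps₁; hyps-ok to ok₁)
    open Translation tr₂ renaming (hyps to hyps₂; hyps-ok to ok₂)

  translate : ∀ {c} (g : Tree GAx c) → tsize g ≤ N → Translation g
  translate (node st []) _ = translate-leaf st
  translate (node st (t ∷ [])) g≤N = translate-unary st (translate t (≤-trans (child₁≤tsize st t []) g≤N)) g≤N
  translate (node st (t₁ ∷ t₂ ∷ [])) g≤N = translate-binary st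
    (translate t₁ (≤-trans (child₁≤tsize st t₁ (t₂ ∷ [])) g≤N))
    (translate t₂ (≤-trans (child₂≤tsize st t₁ t₂ []) g≤N)) g≤N
  translate (node st (_ ∷ _ ∷ _ ∷ _)) _ = ⊥-elim (no-ternary-rule st)

lemma39 : ∃[ c ] ((Γ : List Fm) (Δ : Maybe Fm) (π : List Line)
              → TreeLike π → IsProof GAx π (Γ ⇒ Δ)
              → ∃[ Σπ ] ∃[ σπ ] (All SingleVar Σπ
                  × IsProof NoAx σπ (Σπ ++ Γ ⇒ Δ)
                  × msize Σπ ≤ c * psize π
                  × psize σπ ≤ c * psize π ^ 3
                  × ([] ⊢LK [ ⋀ (map forget Σπ) ])))
lemma39 = 120 , λ Γ Δ π treeLike proof →
  let N = psize π
      g , g≤N = TreeLike⇒Tree treeLike proof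
      open Translate N (≤-trans (1≤tsize g) g≤N)
      open Translation (translate g g≤N)
      σ , σ-proof , σ-size = Tree⇒IsProof derivation
  in hyps , σ , All.map (proj₁ ∘ proj₂) hyps-ok , σ-proof ,
     ≤-trans hyps-size (≤-trans (*-monoʳ-≤ 7 g≤N) (*-monoˡ-≤ N (≤ᵇ⇒≤ 7 120 tt))) ,
     (begin
       psize σ              ≡⟨ σ-size ⟩
       tsize derivation     ≤⟨ derivation-size ⟩
       tsize g * budget     ≤⟨ *-monoˡ-≤ budget g≤N ⟩
       N * budget           ≡⟨ cube N ⟩
       120 * N ^ 3          ∎) ,
     ⊢⋀ (map⁺ (All.map (proj₂ ∘ proj₂) hyps-ok))
  where
  open ≤-Reasoning
  cube : ∀ N → N * (8 * N * (15 * N)) ≡ 120 * N ^ 3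
  cube N = expand N
    where
    expand : ∀ N → N * (8 * N * (15 * N)) ≡ 120 * (N * (N * (N * 1)))
    expand = solve-∀
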